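{- (i) There is an online algorithm with advice for the simple unbounded knapsack problem that reads only a single advice bit and has competitive ratio at most $3/2$. (ii) For any fixed number $k>0$, no online algorithm reading at most $k$ advice bits has competitive ratio less than $3/2$. (iii) For every $n$, any online algorithm with advice that achieves a competitive ratio better than $3/2$ on all instances of length at most $n$ must read more than $\log_2(n-1)$ advice bits (on some such instance).
   Context: Online simple unbounded knapsack problem: knapsack capacity $1$; an instance is a sequence of items $x_1,\dots,x_n$ ($n$ unknown to the algorithm) with sizes $s_i\in[0,1]$ and values $v_i=s_i$. Items arrive one by one; upon arrival of $x_i$ the algorithm irrevocably chooses a number $k_i\in\mathbb{N}_0$ of copies to pack, with the total packed size never exceeding $1$. $\mathrm{opt}(I)=\max\{\sum_i k_i v_i: k_i\in\mathbb{N}_0,\sum_i k_i s_i\le1\}$; the (strict) competitive ratio on $I$ is $\mathrm{opt}(I)/\mathrm{gain}(I)$ where $\mathrm{gain}(I)$ is the total packed value, and the competitive ratio of an algorithm is its supremum over instances. Advice model (tape model): before processing, an oracle that knows the whole instance writes an infinite binary advice string; the deterministic online algorithm may read bits of this string from the beginning. An algorithm uses $f(n)$ advice bits if on every instance with $n$ items it reads at most the first $f(n)$ bits. Its competitive ratio is computed with the oracle supplying the best advice for each instance.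
   Formalization: The item sizes $s_i$ are taken in ℚ ∩ [0,1] instead of the real interval, both for the one-bit algorithm of (i) and for the algorithms and instances of (ii) and (iii). -}

module Defs where

open import Data.Nat as ℕ using (ℕ; _∸_; _^_)
open import Data.Integer using (+_)
open import Data.Rational using (ℚ; 0ℚ; 1ℚ; _+_; _*_; _≤_; _<_; _/_)
open import Data.List using (List; []; _∷_; _++_; [_]; length)
open import Data.List.Relation.Unary.All using (All)
open import Data.Bool using (Bool)
open import Data.Unit using (⊤)
open import Data.Product using (Σ; ∃; _×_; _,_)
open import Relation.Binary.PropositionalEquality using (_≡_)

3/2 : ℚ
3/2 = + 3 / 2

ℕ→ℚ : ℕ → ℚ
ℕ→ℚ k = + k / 1

-- An item is given by its size (= its value); an instance is the list
-- of item sizes in arrival order.  Every size must lie in [0,1].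
Instance : Set
Instance = List ℚ

ValidInst : Instance → Set
ValidInst I = All (λ s → (0ℚ ≤ s) × (s ≤ 1ℚ)) I

Tape : Set
Tape = ℕ → Bool

-- Deterministic online algorithm with advice: given the advice tape and
-- the items seen so far (x₁ … xᵢ, the current item last), it returns
-- the number kᵢ of copies of xᵢ to pack.  Being a function of the prefix
-- only, its decisions are automatically online and irrevocable.
Alg : Set
Alg = Tape → List ℚ → ℕ

decisionsFrom : Alg → Tape → List ℚ → List ℚ → List ℕ
decisionsFrom A t seen []       = []
decisionsFrom A t seen (x ∷ xs) =
  A t (seen ++ [ x ]) ∷ decisionsFrom A t (seen ++ [ x ]) xs

decisions : Alg → Tape → Instance → List ℕ
decisions A t I = decisionsFrom A t [] I

packed : List ℕ → List ℚ → ℚ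
packed (k ∷ ks) (s ∷ ss) = ℕ→ℚ k * s + packed ks ss
packed _        _        = 0ℚ

Feasible : List ℕ → Instance → Set
Feasible ks I = (length ks ≡ length I) × (packed ks I ≤ 1ℚ)

gain : Alg → Tape → Instance → ℚ
gain A t I = packed (decisions A t I) I

ValidAlg : Alg → Set
ValidAlg A = ∀ (t : Tape) (I : Instance) → ValidInst I → packed (decisions A t I) I ≤ 1ℚ

-- A reads at most b advice bits on every (valid) instance satisfying P:
-- its decisions on such an instance depend only on the first b bits.
ReadsAtMost : Alg → ℕ → (Instance → Set) → Set
ReadsAtMost A b P =
  ∀ (I : Instance) → ValidInst I → P I →
  ∀ (t t' : Tape) → (∀ i → i ℕ.< b → t i ≡ t' i) →
  decisions A t I ≡ decisions A t' I

-- With best advice, A has strict ratio opt(I)/gain(I) ≤ r on every valid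
-- instance satisfying P.  "opt(I) ≤ r · gain" is unfolded as: every
-- feasible offline solution has value ≤ r · gain.
CompetitiveOn : Alg → ℚ → (Instance → Set) → Set
CompetitiveOn A r P =
  ∀ (I : Instance) → ValidInst I → P I →
  Σ Tape λ t → ∀ (ks : List ℕ) → Feasible ks I → packed ks I ≤ r * gain A t I

AllInstances : Instance → Set
AllInstances _ = ⊤

LengthAtMost : ℕ → Instance → Set
LengthAtMost n I = length I ℕ.≤ n

{-# OPTIONS --safe #-}
module Submission where

-- (i) The advice bit tells whether the instance contains a good item, one of size in
-- (0, ½] ∪ [⅔, 1]. If it does, the algorithm packs ⌊1/x⌋ copies of the first good item x,
-- which fill at least ⅔ of the knapsack. If it does not, every item is 0 or lies in (½, ⅔),
-- so no two positive copies fit together and opt ≤ ⅔, while ⌊1/x⌋ copies of the first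
-- positive item fill more than ½.
--
-- (iii) Measure sizes in units of 1/T, T = 3M with M large. The items 2M − 1 − l
-- (l = 0, 1, …), decreasing and just below ⅔, arrive one by one. For j < m the j-th hard
-- instance stops after item j and appends its complement M + 1 + j; the last one appends an
-- item of size 1 after m prefix items. Every hard instance has optimum 1, and a ratio below
-- 3/2 forces a gain which only packing exactly item j and its complement, resp. only the
-- item of size 1, achieves. Hence the number of prefix items the algorithm skips determines
-- the instance, yet depends only on the advice bits read: m + 1 ≤ 2^b. (ii) is (iii) for
-- n = 2^k + 1.

open import Defs
open import Data.Nat as ℕ using (ℕ; zero; suc; _∸_; _^_)
open import Data.Bool using (Bool; true; false; if_then_else_; _∨_)
open import Data.Bool.ListAction using (any)
open import Data.Bool.Properties using (∨-identityʳ; ∨-assoc)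
open import Data.Empty using (⊥-elim)
open import Data.Fin as Fin using (Fin; toℕ; combine)
import Data.Fin.Properties as Fin
open import Data.List using (List; []; _∷_; _++_; [_]; length; replicate)
import Data.List.Properties as List
open import Data.List.Relation.Unary.All as All using (All; []; _∷_)
open import Data.List.Relation.Unary.All.Properties using (¬Any⇒All¬; ++⁺)
open import Data.List.Relation.Unary.Any using (Any; here; there; any?)
open import Data.Product using (Σ; _×_; _,_; proj₁; proj₂)
open import Data.Sum using (_⊎_; inj₁; inj₂)
open import Data.Unit using (tt)
open import Function using (_∘_)
open import Function.Definitions using (Injective)
open import Relation.Binary.PropositionalEquality hiding ([_])
open import Relation.Nullary using (¬_; yes; no; does)
open import Relation.Nullary.Decidable using (_×-dec_; _⊎-dec_; toWitness)
open import Relation.Unary using (Decidable)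

module FloorMultiple where

  open import Data.Nat
  open import Data.Nat.DivMod
  open import Data.Nat.Properties

  m<m/n*n+n : ∀ m n .{{_ : NonZero n}} → m < m / n * n + n
  m<m/n*n+n m n = begin-strict
    m                  ≡⟨ m≡m%n+[m/n]*n m n ⟩
    m % n + m / n * n  <⟨ +-monoˡ-< (m / n * n) (m%n<n m n) ⟩
    n + m / n * n      ≡⟨ +-comm n (m / n * n) ⟩
    m / n * n + n      ∎
    where open ≤-Reasoning

  2m≤3[m/n*n] : ∀ m n .{{_ : NonZero n}} → n ≤ m → 2 * n ≤ m ⊎ 2 * m ≤ 3 * n →
    2 * m ≤ 3 * (m / n * n)
  2m≤3[m/n*n] m n n≤m (inj₂ 2m≤3n) = begin
    2 * m            ≤⟨ 2m≤3n ⟩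
    3 * n            ≤⟨ *-monoʳ-≤ 3 (m≤n*m n (m / n) {{>-nonZero (m≥n⇒m/n>0 n≤m)}}) ⟩
    3 * (m / n * n)  ∎
    where open ≤-Reasoning
  2m≤3[m/n*n] m n n≤m (inj₁ 2n≤m) = <⇒≤ (begin-strict
    2 * m            <⟨ *-monoʳ-< 2 (m<m/n*n+n m n) ⟩
    2 * (r + n)      ≡⟨ *-distribˡ-+ 2 r n ⟩
    2 * r + 2 * n    ≤⟨ +-monoʳ-≤ (2 * r) 2n≤r ⟩
    2 * r + r        ≡⟨ +-comm (2 * r) r ⟩
    3 * r            ∎)
    where
    open ≤-Reasoning
    r = m / n * n
    2n≤r : 2 * n ≤ r
    2n≤r = *-monoˡ-≤ n (begin
      2          ≡⟨ m*n/n≡m 2 n ⟨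
      2 * n / n  ≤⟨ /-monoˡ-≤ n 2n≤m ⟩
      m / n      ∎)

-- The prefix items big l lie just below ⅔, so any two of them
-- overflow, and small l complements big l exactly. Window V says that a gain of V/T fits
-- and exceeds the threshold B/T of ratio-threshold.
module PrefixLoad (M n : ℕ) (room : 2 ℕ.* n ℕ.< M) where

  open import Data.Nat
  open import Data.Nat.Properties
  open import Data.Nat.Tactic.RingSolver using (solve-∀)

  T B X : ℕ
  T = 3 * M
  B = 2 * M + 2 * n
  X = 2 * M ∸ n

  big small : ℕ → ℕ
  big l   = 2 * M ∸ suc l
  small l = M + suc l

  load : (ℕ → ℕ) → ℕ → ℕ
  load ρ zero    = 0
  load ρ (suc k) = load ρ k + ρ k * big k

  Window : ℕ → Set
  Window V = B < V × V ≤ T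

  n≤2M : n ≤ 2 * M
  n≤2M = ≤-trans (m≤n*m n 2) (≤-trans (<⇒≤ room) (m≤n*m M 2))

  T<2X : T < 2 * X
  T<2X = +-cancelʳ-< (2 * n) T (2 * X) (begin-strict
    T + 2 * n        <⟨ +-monoʳ-< T room ⟩
    T + M            ≡⟨ 3m+m≡2[2m] M ⟩
    2 * (2 * M)      ≡⟨ cong (2 *_) (m∸n+n≡m n≤2M) ⟨
    2 * (X + n)      ≡⟨ *-distribˡ-+ 2 X n ⟩
    2 * X + 2 * n    ∎)
    where
    open ≤-Reasoning
    3m+m≡2[2m] : ∀ m → 3 * m + m ≡ 2 * (2 * m)
    3m+m≡2[2m] = solve-∀

  0<X : 0 < X
  0<X = *-cancelˡ-< 2 0 X (≤-<-trans z≤n T<2X)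

  X≤2M∸ : ∀ {k} → k ≤ n → X ≤ 2 * M ∸ k
  X≤2M∸ k≤n = ∸-monoʳ-≤ (2 * M) k≤n

  X≤big : ∀ {l} → l < n → X ≤ big l
  X≤big = X≤2M∸

  big≤2M : ∀ l → big l ≤ 2 * M
  big≤2M l = m∸n≤m (2 * M) (suc l)

  big≤T : ∀ l → big l ≤ T
  big≤T l = ≤-trans (big≤2M l) (m≤n+m (2 * M) M)

  small≤T : ∀ {k} → k < n → small k ≤ T
  small≤T k<n = +-monoʳ-≤ M (≤-trans k<n n≤2M)

  big+small≡T : ∀ {k} → k < n → big k + small k ≡ T
  big+small≡T {k} k<n = begin-equality
    2 * M ∸ suc k + (M + suc k)  ≡⟨ cong (2 * M ∸ suc k +_) (+-comm M (suc k)) ⟩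
    2 * M ∸ suc k + (suc k + M)  ≡⟨ +-assoc (2 * M ∸ suc k) (suc k) M ⟨
    2 * M ∸ suc k + suc k + M    ≡⟨ cong (_+ M) (m∸n+n≡m (≤-trans k<n n≤2M)) ⟩
    2 * M + M                    ≡⟨ +-comm (2 * M) M ⟩
    T                            ∎
    where open ≤-Reasoning

  T<2M∸k+small : ∀ {k} → k ≤ 2 * M → T < 2 * M ∸ k + small k
  T<2M∸k+small {k} k≤2M = begin-strict
    T                        ≡⟨ +-comm M (2 * M) ⟩
    2 * M + M                ≡⟨ cong (_+ M) (m∸n+n≡m k≤2M) ⟨
    2 * M ∸ k + k + M        <⟨ n<1+n _ ⟩
    suc (2 * M ∸ k + k + M)  ≡⟨ a+[m+1+k]≡1+a+k+m (2 * M ∸ k) k M ⟨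
    2 * M ∸ k + small k      ∎
    where
    open ≤-Reasoning
    a+[m+1+k]≡1+a+k+m : ∀ a k m → a + (m + suc k) ≡ suc (a + k + m)
    a+[m+1+k]≡1+a+k+m = solve-∀

  overflow : ∀ {a b} → X ≤ a → X ≤ b → T < a + b
  overflow X≤a X≤b =
    <-≤-trans T<2X (+-mono-≤ X≤a (≤-trans (≤-reflexive (+-identityʳ X)) X≤b))

  load-dichotomy : ∀ ρ k → load ρ k ≡ 0 ⊎ 2 * M ∸ k ≤ load ρ k
  load-dichotomy ρ zero = inj₁ refl
  load-dichotomy ρ (suc k) with ρ k | load-dichotomy ρ k
  ... | zero  | inj₁ L≡0  = inj₁ (trans (+-identityʳ (load ρ k)) L≡0)
  ... | zero  | inj₂ lo≤L =
    inj₂ (≤-trans (∸-monoʳ-≤ (2 * M) (n≤1+n k)) (≤-trans lo≤L (m≤m+n (load ρ k) 0)))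
  ... | suc r | _         = inj₂ (≤-trans (m≤m+n (big k) (r * big k)) (m≤n+m _ (load ρ k)))

  load≡0⇒zeros : ∀ ρ k → k ≤ n → load ρ k ≡ 0 → ∀ l → l < k → ρ l ≡ 0
  load≡0⇒zeros ρ (suc k) k<n L≡0 l l<1+k with m≤n⇒m<n∨m≡n (s≤s⁻¹ l<1+k)
  ... | inj₁ l<k  = load≡0⇒zeros ρ k (<⇒≤ k<n) (m+n≡0⇒m≡0 (load ρ k) L≡0) l l<k
  ... | inj₂ refl with m*n≡0⇒m≡0∨n≡0 (ρ l) (m+n≡0⇒n≡0 (load ρ l) L≡0)
  ...   | inj₁ ρl≡0  = ρl≡0
  ...   | inj₂ big≡0 = ⊥-elim (<⇒≢ (<-≤-trans 0<X (X≤big k<n)) (sym big≡0))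

  load≤T⇒≤2M : ∀ ρ k → k ≤ n → load ρ k ≤ T → load ρ k ≤ 2 * M
  load≤T⇒≤2M ρ zero _ _ = z≤n
  load≤T⇒≤2M ρ (suc k) k<n L≤T with ρ k | load-dichotomy ρ k
  ... | zero | _ = ≤-trans (≤-reflexive (+-identityʳ (load ρ k)))
    (load≤T⇒≤2M ρ k (<⇒≤ k<n) (≤-trans (m≤m+n (load ρ k) 0) L≤T))
  ... | suc zero | inj₁ L≡0 rewrite L≡0 =
    ≤-trans (≤-reflexive (+-identityʳ (big k))) (big≤2M k)
  ... | suc (suc r) | inj₁ _ = ⊥-elim (<⇒≱ (<-≤-trans
    (overflow (X≤big k<n) (≤-trans (X≤big k<n) (m≤m+n (big k) (r * big k))))
    (m≤n+m _ (load ρ k))) L≤T)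
  ... | suc r | inj₂ lo≤L = ⊥-elim (<⇒≱ (overflow
    (≤-trans (X≤2M∸ (<⇒≤ k<n)) lo≤L) (≤-trans (X≤big k<n) (m≤m+n (big k) (r * big k)))) L≤T)

  ¬Window-≤2M : ∀ {V} → V ≤ 2 * M → ¬ Window V
  ¬Window-≤2M V≤2M (B<V , _) = <⇒≱ B<V (≤-trans V≤2M (m≤m+n (2 * M) (2 * n)))

  ¬Window->T : ∀ {V} → T < V → ¬ Window V
  ¬Window->T T<V (_ , V≤T) = <⇒≱ T<V V≤T

  ¬Window-small : ∀ {k} e → k < n → ¬ Window (e * small k)
  ¬Window-small {k} e k<n with e ≤? 2
  ... | yes e≤2 = λ (B<V , _) → <⇒≱ B<V (begin
    e * small k        ≤⟨ *-monoˡ-≤ (small k) e≤2 ⟩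
    2 * (M + suc k)    ≡⟨ *-distribˡ-+ 2 M (suc k) ⟩
    2 * M + 2 * suc k  ≤⟨ +-monoʳ-≤ (2 * M) (*-monoʳ-≤ 2 k<n) ⟩
    B                  ∎)
    where open ≤-Reasoning
  ... | no e≰2 =
    ¬Window->T (<-≤-trans (*-monoʳ-< 3 (m<m+n M z<s)) (*-monoˡ-≤ (small k) (≰⇒> e≰2)))

  ¬Window-loaded : ∀ {k L} r e → k < n → 2 * M ∸ k ≤ L → (L ≤ T → L ≤ 2 * M) →
    ¬ Window (L + r * big k + e * small k)
  ¬Window-loaded {k} {L} zero zero _ _ single w@(_ , V≤T) =
    ¬Window-≤2M (≤-trans (≤-reflexive L+0+0≡L)
      (single (≤-trans (≤-reflexive (sym L+0+0≡L)) V≤T))) w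
    where
    L+0+0≡L : L + 0 + 0 ≡ L
    L+0+0≡L = trans (+-identityʳ (L + 0)) (+-identityʳ L)
  ¬Window-loaded {k} {L} (suc r) e k<n lo≤L _ = ¬Window->T (<-≤-trans
    (overflow (≤-trans (X≤2M∸ (<⇒≤ k<n)) lo≤L) (≤-trans (X≤big k<n) (m≤m+n (big k) (r * big k))))
    (m≤m+n (L + suc r * big k) (e * small k)))
  ¬Window-loaded {k} {L} zero (suc e) k<n lo≤L _ = ¬Window->T (begin-strict
    T                                <⟨ T<2M∸k+small (≤-trans (<⇒≤ k<n) n≤2M) ⟩
    2 * M ∸ k + small k              ≤⟨ +-mono-≤ (≤-trans lo≤L (m≤m+n L 0))
                                                  (m≤m+n (small k) (e * small k)) ⟩
    L + 0 + (small k + e * small k)  ∎)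
    where open ≤-Reasoning

  forced-split : ∀ ρ k e → k < n → Window (load ρ (suc k) + e * small k) →
    load ρ k ≡ 0 × ρ k ≢ 0
  forced-split ρ k e k<n w with load-dichotomy ρ k
  ... | inj₂ lo≤L = ⊥-elim (¬Window-loaded (ρ k) e k<n lo≤L (load≤T⇒≤2M ρ k (<⇒≤ k<n)) w)
  ... | inj₁ L≡0  = L≡0 , λ ρk≡0 →
    ¬Window-small e k<n (subst Window (cong₂ (λ L r → L + r * big k + e * small k) L≡0 ρk≡0) w)

  forced-empty : ∀ ρ k e → k ≤ n → Window (load ρ k + e * T) → load ρ k ≡ 0
  forced-empty ρ k e k≤n w with load-dichotomy ρ k | e
  ... | inj₁ L≡0  | _      = L≡0
  ... | inj₂ _    | zero   = ⊥-elim (¬Window-≤2M (≤-trans (≤-reflexive L+0≡L)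
    (load≤T⇒≤2M ρ k k≤n (≤-trans (≤-reflexive (sym L+0≡L)) (proj₂ w)))) w)
    where
    L+0≡L : load ρ k + 0 ≡ load ρ k
    L+0≡L = +-identityʳ (load ρ k)
  ... | inj₂ lo≤L | suc e' = ⊥-elim (¬Window->T (begin-strict
    T                        <⟨ m<n+m T (<-≤-trans 0<X (≤-trans (X≤2M∸ k≤n) lo≤L)) ⟩
    load ρ k + T             ≤⟨ +-monoʳ-≤ (load ρ k) (m≤m+n T (e' * T)) ⟩
    load ρ k + (T + e' * T)  ∎) w)
    where open ≤-Reasoning

-- For r = a/(q + 1) < 3/2, i.e. 2a + 1 ≤ 3(q + 1), the scale M exceeds 2an, which absorbs the
-- excess of a(2M + 2n) over (2a + 1)M; hence r·V/(3M) < 1 for all V ≤ 2M + 2n.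
module Scale (a n : ℕ) where

  open import Data.Nat
  open import Data.Nat.Properties
  open import Data.Nat.Tactic.RingSolver using (solve-∀)

  M : ℕ
  M = suc (2 * (suc a * n))

  2n<M : 2 * n < M
  2n<M = s≤s (*-monoʳ-≤ 2 (m≤n*m n (suc a)))

  a2n<M : a * (2 * n) < M
  a2n<M = s≤s (begin
    a * (2 * n)      ≡⟨ a[2n]≡2[an] a n ⟩
    2 * (a * n)      ≤⟨ *-monoʳ-≤ 2 (*-monoˡ-≤ n (n≤1+n a)) ⟩
    2 * (suc a * n)  ∎)
    where
    open ≤-Reasoning
    a[2n]≡2[an] : ∀ a n → a * (2 * n) ≡ 2 * (a * n)
    a[2n]≡2[an] = solve-∀

  aV<[1+q]T : ∀ q V → suc (a * 2) ≤ 3 * suc q → V ≤ 2 * M + 2 * n → a * V < suc q * (3 * M)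
  aV<[1+q]T q V 1+2a≤3[1+q] V≤B = begin-strict
    a * V                      ≤⟨ *-monoʳ-≤ a V≤B ⟩
    a * (2 * M + 2 * n)        ≡⟨ a[2m+2n]≡a2m+a2n a M n ⟩
    a * 2 * M + a * (2 * n)    <⟨ +-monoʳ-< (a * 2 * M) a2n<M ⟩
    a * 2 * M + M              ≡⟨ a2m+m≡[1+a2]m a M ⟩
    suc (a * 2) * M            ≤⟨ *-monoˡ-≤ M 1+2a≤3[1+q] ⟩
    3 * suc q * M              ≡⟨ [3q]m≡q[3m] (suc q) M ⟩
    suc q * (3 * M)            ∎
    where
    open ≤-Reasoning
    a[2m+2n]≡a2m+a2n : ∀ a m n → a * (2 * m + 2 * n) ≡ a * 2 * m + a * (2 * n)
    a[2m+2n]≡a2m+a2n = solve-∀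
    a2m+m≡[1+a2]m : ∀ a m → a * 2 * m + m ≡ suc (a * 2) * m
    a2m+m≡[1+a2]m = solve-∀
    [3q]m≡q[3m] : ∀ q m → 3 * q * m ≡ q * (3 * m)
    [3q]m≡q[3m] = solve-∀

open import Data.Integer as ℤ using (+_; -[1+_]; +≤+; +<+)
import Data.Integer.Properties as ℤ
import Data.Nat.DivMod as ℕ
import Data.Nat.Properties as ℕ
open import Data.Nat.Coprimality using (Coprime)
open import Data.Rational as ℚ using (ℚ; mkℚ; _/_; _+_; _*_; _≤_; _<_; 0ℚ; 1ℚ; ½; toℚᵘ)
import Data.Rational.Properties as ℚ
import Data.Rational.Unnormalised as ℚᵘ
import Data.Rational.Unnormalised.Properties as ℚᵘ

-- Fractions

-- fromℚᵘ (mkℚᵘ i n) reduces to i / suc n.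
toℚᵘ-/ : ∀ i n → toℚᵘ (i / suc n) ℚᵘ.≃ ℚᵘ.mkℚᵘ i n
toℚᵘ-/ i n = ℚ.toℚᵘ-fromℚᵘ (ℚᵘ.mkℚᵘ i n)

/-mono-≤ : ∀ a b m n → a ℕ.* suc n ℕ.≤ b ℕ.* suc m → + a / suc m ≤ + b / suc n
/-mono-≤ a b m n h = ℚ.toℚᵘ-cancel-≤
  (ℚᵘ.≤-respˡ-≃ (ℚᵘ.≃-sym (toℚᵘ-/ (+ a) m))
  (ℚᵘ.≤-respʳ-≃ (ℚᵘ.≃-sym (toℚᵘ-/ (+ b) n))
  (ℚᵘ.*≤* (subst₂ ℤ._≤_ (ℤ.pos-* a (suc n)) (ℤ.pos-* b (suc m)) (+≤+ h)))))

/-mono-< : ∀ a b m n → a ℕ.* suc n ℕ.< b ℕ.* suc m → + a / suc m < + b / suc n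
/-mono-< a b m n h = ℚ.toℚᵘ-cancel-<
  (ℚᵘ.<-respˡ-≃ (ℚᵘ.≃-sym (toℚᵘ-/ (+ a) m))
  (ℚᵘ.<-respʳ-≃ (ℚᵘ.≃-sym (toℚᵘ-/ (+ b) n))
  (ℚᵘ.*<* (subst₂ ℤ._<_ (ℤ.pos-* a (suc n)) (ℤ.pos-* b (suc m)) (+<+ h)))))

/-cancel-≤ : ∀ a b m n → + a / suc m ≤ + b / suc n → a ℕ.* suc n ℕ.≤ b ℕ.* suc m
/-cancel-≤ a b m n h = ℕ.≮⇒≥ λ lt → ℚ.<-irrefl refl (ℚ.<-≤-trans (/-mono-< b a n m lt) h)

/-cancel-< : ∀ a b m n → + a / suc m < + b / suc n → a ℕ.* suc n ℕ.< b ℕ.* suc m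
/-cancel-< a b m n h = ℕ.≰⇒> λ le → ℚ.<-irrefl refl (ℚ.<-≤-trans h (/-mono-≤ b a n m le))

≤⇒/≤1 : ∀ a n → a ℕ.≤ suc n → + a / suc n ≤ 1ℚ
≤⇒/≤1 a n h = /-mono-≤ a 1 n 0
  (subst₂ ℕ._≤_ (sym (ℕ.*-identityʳ a)) (sym (ℕ.+-identityʳ (suc n))) h)

<⇒/<1 : ∀ a n → a ℕ.< suc n → + a / suc n < 1ℚ
<⇒/<1 a n h = /-mono-< a 1 n 0
  (subst₂ ℕ._<_ (sym (ℕ.*-identityʳ a)) (sym (ℕ.+-identityʳ (suc n))) h)

/≤1⇒≤ : ∀ a n → + a / suc n ≤ 1ℚ → a ℕ.≤ suc n
/≤1⇒≤ a n h = subst₂ ℕ._≤_ (ℕ.*-identityʳ a) (ℕ.+-identityʳ (suc n)) (/-cancel-≤ a 1 n 0 h)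

0≤/ : ∀ a n → 0ℚ ≤ + a / suc n
0≤/ a n = /-mono-≤ 0 a 0 n ℕ.z≤n

/-*-interchange : ∀ a b m n → + (a ℕ.* b) / (suc m ℕ.* suc n) ≡ (+ a / suc m) * (+ b / suc n)
/-*-interchange a b m n = sym (ℚ.toℚᵘ-injective (begin-equality
  toℚᵘ (x * y)                                ≃⟨ ℚ.toℚᵘ-homo-* x y ⟩
  toℚᵘ x ℚᵘ.* toℚᵘ y                          ≃⟨ ℚᵘ.*-cong (toℚᵘ-/ (+ a) m) (toℚᵘ-/ (+ b) n) ⟩
  ℚᵘ.mkℚᵘ (+ a) m ℚᵘ.* ℚᵘ.mkℚᵘ (+ b) n        ≡⟨ cong (λ i → ℚᵘ.mkℚᵘ i _) (ℤ.pos-* a b) ⟨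
  ℚᵘ.mkℚᵘ (+ (a ℕ.* b)) (n ℕ.+ m ℕ.* suc n)   ≃⟨ toℚᵘ-/ (+ (a ℕ.* b)) _ ⟨
  toℚᵘ (+ (a ℕ.* b) / (suc m ℕ.* suc n))      ∎))
  where
  open ℚᵘ.≤-Reasoning
  x = + a / suc m
  y = + b / suc n

*-/-assoc : ∀ k a n → + (k ℕ.* a) / suc n ≡ ℕ→ℚ k * (+ a / suc n)
*-/-assoc k a n =
  trans (ℚ./-cong {+ (k ℕ.* a)} refl (sym (ℕ.*-identityˡ (suc n)))) (/-*-interchange k a 0 n)

+-distrib-/ : ∀ a b n → + (a ℕ.+ b) / suc n ≡ + a / suc n + + b / suc n
+-distrib-/ a b n = sym (ℚ.toℚᵘ-injective (begin-equality
  toℚᵘ (x + y)                            ≃⟨ ℚ.toℚᵘ-homo-+ x y ⟩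
  toℚᵘ x ℚᵘ.+ toℚᵘ y                      ≃⟨ ℚᵘ.+-cong (toℚᵘ-/ (+ a) n) (toℚᵘ-/ (+ b) n) ⟩
  ℚᵘ.mkℚᵘ (+ a) n ℚᵘ.+ ℚᵘ.mkℚᵘ (+ b) n    ≃⟨ ℚᵘ.*≡* cross ⟩
  ℚᵘ.mkℚᵘ (+ (a ℕ.+ b)) n                 ≃⟨ toℚᵘ-/ (+ (a ℕ.+ b)) n ⟨
  toℚᵘ (+ (a ℕ.+ b) / suc n)              ∎))
  where
  open ℚᵘ.≤-Reasoning
  x = + a / suc n
  y = + b / suc n
  s = + suc n
  cross : (+ a ℤ.* s ℤ.+ + b ℤ.* s) ℤ.* s ≡ + (a ℕ.+ b) ℤ.* + (suc n ℕ.* suc n)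
  cross = trans (cong (ℤ._* s) (sym (ℤ.*-distribʳ-+ s (+ a) (+ b))))
         (trans (ℤ.*-assoc (+ a ℤ.+ + b) s s)
                (sym (cong₂ ℤ._*_ (ℤ.pos-+ a b) (ℤ.pos-* (suc n) (suc n)))))

0≤k*x : ∀ k {x} → 0ℚ ≤ x → 0ℚ ≤ ℕ→ℚ k * x
0≤k*x k {x} 0≤x =
  subst (_≤ ℕ→ℚ k * x) (ℚ.*-zeroˡ x) (ℚ.*-monoʳ-≤-nonNeg x {{ℚ.nonNegative 0≤x}} (0≤/ k 0))

≤0⇒≯0 : ∀ x .{{_ : ℚ.NonPositive x}} → ¬ (0ℚ < x)
≤0⇒≯0 x 0<x = ℚ.<-irrefl refl (ℚ.<-≤-trans 0<x (ℚ.nonPositive⁻¹ x))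

-- Decisions and packings

length-∷ʳ : ∀ {A : Set} (xs : List A) x → length (xs ++ [ x ]) ≡ suc (length xs)
length-∷ʳ xs x = trans (List.length-++ xs) (ℕ.+-comm (length xs) 1)

decisionsFrom-++ : ∀ A t seen I J →
  decisionsFrom A t seen (I ++ J) ≡ decisionsFrom A t seen I ++ decisionsFrom A t (seen ++ I) J
decisionsFrom-++ A t seen []      J = cong (λ s → decisionsFrom A t s J) (sym (List.++-identityʳ seen))
decisionsFrom-++ A t seen (x ∷ I) J = cong (A t seen′ ∷_) (begin
  decisionsFrom A t seen′ (I ++ J)
    ≡⟨ decisionsFrom-++ A t seen′ I J ⟩
  decisionsFrom A t seen′ I ++ decisionsFrom A t (seen′ ++ I) J
    ≡⟨ cong (λ s → decisionsFrom A t seen′ I ++ decisionsFrom A t s J) (List.++-assoc seen [ x ] I) ⟩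
  decisionsFrom A t seen′ I ++ decisionsFrom A t (seen ++ x ∷ I) J ∎)
  where
  open ≡-Reasoning
  seen′ = seen ++ [ x ]

decisions-∷ʳ : ∀ A t I x → decisions A t (I ++ [ x ]) ≡ decisions A t I ++ [ A t (I ++ [ x ]) ]
decisions-∷ʳ A t I x = decisionsFrom-++ A t [] I [ x ]

length-decisionsFrom : ∀ A t seen I → length (decisionsFrom A t seen I) ≡ length I
length-decisionsFrom A t seen []      = refl
length-decisionsFrom A t seen (x ∷ I) = cong suc (length-decisionsFrom A t (seen ++ [ x ]) I)

decisionsFrom-cong : ∀ {A A' t t'} → (∀ s → A t s ≡ A' t' s) →
  ∀ seen I → decisionsFrom A t seen I ≡ decisionsFrom A' t' seen I
decisionsFrom-cong eq seen []      = refl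
decisionsFrom-cong eq seen (x ∷ I) =
  cong₂ _∷_ (eq (seen ++ [ x ])) (decisionsFrom-cong eq (seen ++ [ x ]) I)

last-decision : ∀ {A t t'} I x → decisions A t (I ++ [ x ]) ≡ decisions A t' (I ++ [ x ]) →
  A t (I ++ [ x ]) ≡ A t' (I ++ [ x ])
last-decision {A} {t} {t'} I x eq = proj₂ (List.∷ʳ-injective (decisions A t I) (decisions A t' I)
  (trans (sym (decisions-∷ʳ A t I x)) (trans eq (decisions-∷ʳ A t' I x))))

packed-++ : ∀ ks ks' I I' → length ks ≡ length I →
  packed (ks ++ ks') (I ++ I') ≡ packed ks I + packed ks' I'
packed-++ []       ks' []      I' _  = sym (ℚ.+-identityˡ (packed ks' I'))
packed-++ (k ∷ ks) ks' (x ∷ I) I' eq = begin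
  v + packed (ks ++ ks') (I ++ I')   ≡⟨ cong (_+_ v) (packed-++ ks ks' I I' (ℕ.suc-injective eq)) ⟩
  v + (packed ks I + packed ks' I')  ≡⟨ ℚ.+-assoc v (packed ks I) (packed ks' I') ⟨
  v + packed ks I + packed ks' I'    ∎
  where
  open ≡-Reasoning
  v = ℕ→ℚ k * x

gain-∷ʳ : ∀ A t I x → gain A t (I ++ [ x ]) ≡ gain A t I + ℕ→ℚ (A t (I ++ [ x ])) * x
gain-∷ʳ A t I x = begin
  packed (decisions A t (I ++ [ x ])) (I ++ [ x ])
    ≡⟨ cong (λ ks → packed ks (I ++ [ x ])) (decisions-∷ʳ A t I x) ⟩
  packed (decisions A t I ++ [ k ]) (I ++ [ x ])
    ≡⟨ packed-++ (decisions A t I) [ k ] I [ x ] (length-decisionsFrom A t [] I) ⟩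
  gain A t I + (ℕ→ℚ k * x + 0ℚ)
    ≡⟨ cong (_+_ (gain A t I)) (ℚ.+-identityʳ (ℕ→ℚ k * x)) ⟩
  gain A t I + ℕ→ℚ k * x ∎
  where
  open ≡-Reasoning
  k = A t (I ++ [ x ])

packed-nonneg : ∀ {I} → ValidInst I → ∀ ks → 0ℚ ≤ packed ks I
packed-nonneg _        []       = ℚ.≤-refl
packed-nonneg []       (_ ∷ _)  = ℚ.≤-refl
packed-nonneg (v ∷ vs) (k ∷ ks) = ℚ.+-mono-≤ (0≤k*x k (proj₁ v)) (packed-nonneg vs ks)

packed-zeros : ∀ {I} → All (_≡ 0ℚ) I → ∀ ks → packed ks I ≡ 0ℚ
packed-zeros _           []       = refl
packed-zeros []          (_ ∷ _)  = refl
packed-zeros (refl ∷ zs) (k ∷ ks) = cong₂ _+_ (ℚ.*-zeroʳ (ℕ→ℚ k)) (packed-zeros zs ks)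

packed-replicate-0 : ∀ I → packed (replicate (length I) 0) I ≡ 0ℚ
packed-replicate-0 []      = refl
packed-replicate-0 (x ∷ I) =
  trans (cong₂ _+_ (ℚ.*-zeroˡ x) (packed-replicate-0 I)) (ℚ.+-identityˡ 0ℚ)

Fillable : Instance → Set
Fillable I = Σ (List ℕ) λ ks → Feasible ks I × packed ks I ≡ 1ℚ

Fillable-++ : ∀ I {J} → Fillable J → Fillable (I ++ J)
Fillable-++ I {J} (ks , (ks∼J , _) , full) = zs ++ ks , (length≡ , ℚ.≤-reflexive full') , full'
  where
  zs = replicate (length I) 0
  full' : packed (zs ++ ks) (I ++ J) ≡ 1ℚ
  full' = begin
    packed (zs ++ ks) (I ++ J)  ≡⟨ packed-++ zs ks I J (List.length-replicate (length I)) ⟩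
    packed zs I + packed ks J   ≡⟨ cong₂ _+_ (packed-replicate-0 I) full ⟩
    0ℚ + 1ℚ                     ≡⟨ ℚ.+-identityˡ 1ℚ ⟩
    1ℚ                          ∎
    where open ≡-Reasoning
  length≡ : length (zs ++ ks) ≡ length (I ++ J)
  length≡ = begin
    length (zs ++ ks)        ≡⟨ List.length-++ zs ⟩
    length zs ℕ.+ length ks  ≡⟨ cong₂ ℕ._+_ (List.length-replicate (length I)) ks∼J ⟩
    length I ℕ.+ length J    ≡⟨ List.length-++ I ⟨
    length (I ++ J)          ∎
    where open ≡-Reasoning

-- The one-bit algorithm

copies : ℚ → ℕ
copies (mkℚ (+ suc a) d _) = suc d ℕ./ suc a
copies _                   = 0

fill : ℚ → ℚ
fill x = ℕ→ℚ (copies x) * x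

fill≡/ : ∀ a d .(c : Coprime (suc a) (suc d)) →
  fill (mkℚ (+ suc a) d c) ≡ + (copies (mkℚ (+ suc a) d c) ℕ.* suc a) / suc d
fill≡/ a d c =
  trans (cong (ℕ→ℚ (copies x) *_) (sym (ℚ.↥p/↧p≡p x))) (sym (*-/-assoc (copies x) (suc a) d))
  where x = mkℚ (+ suc a) d c

fill≤1 : ∀ x → fill x ≤ 1ℚ
fill≤1 x@(mkℚ (+ suc a) d c) =
  subst (_≤ 1ℚ) (sym (fill≡/ a d c)) (≤⇒/≤1 _ d (ℕ.m/n*n≤m (suc d) (suc a)))
fill≤1 x@(mkℚ (+ zero) d c)  = subst (_≤ 1ℚ) (sym (ℚ.*-zeroˡ x)) (ℚ.nonNegative⁻¹ 1ℚ)
fill≤1 x@(mkℚ -[1+ _ ] d c)  = subst (_≤ 1ℚ) (sym (ℚ.*-zeroˡ x)) (ℚ.nonNegative⁻¹ 1ℚ)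

≤fill : ∀ x → 0ℚ < x → x ≤ 1ℚ → x ≤ fill x
≤fill x@(mkℚ (+ suc a) d c) _ x≤1 = subst₂ _≤_ (ℚ.↥p/↧p≡p x) (sym (fill≡/ a d c))
  (/-mono-≤ (suc a) (k ℕ.* suc a) d d (ℕ.*-monoˡ-≤ (suc d) (ℕ.m≤n*m (suc a) k {{k≢0}})))
  where
  k = copies x
  a≤d = /≤1⇒≤ (suc a) d (subst (_≤ 1ℚ) (sym (ℚ.↥p/↧p≡p x)) x≤1)
  k≢0 = ℕ.>-nonZero (ℕ.m≥n⇒m/n>0 a≤d)
≤fill x@(mkℚ (+ zero) d c) 0<x _ = ⊥-elim (≤0⇒≯0 x 0<x)
≤fill x@(mkℚ -[1+ _ ] d c) 0<x _ = ⊥-elim (≤0⇒≯0 x 0<x)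

⅔ : ℚ
⅔ = + 2 / 3

Good : ℚ → Set
Good x = (0ℚ < x × x ≤ ½) ⊎ ⅔ ≤ x

good? : Decidable Good
good? x = (0ℚ ℚ.<? x ×-dec x ℚ.≤? ½) ⊎-dec ⅔ ℚ.≤? x

Good⇒0< : ∀ {x} → Good x → 0ℚ < x
Good⇒0< (inj₁ (0<x , _)) = 0<x
Good⇒0< (inj₂ ⅔≤x)       = ℚ.<-≤-trans (ℚ.positive⁻¹ ⅔) ⅔≤x

Good⇒⅔≤fill : ∀ x → x ≤ 1ℚ → Good x → ⅔ ≤ fill x
Good⇒⅔≤fill x@(mkℚ (+ suc a) d c) x≤1 g = subst (⅔ ≤_) (sym (fill≡/ a d c))
  (/-mono-≤ 2 (k ℕ.* suc a) 2 d (subst₂ ℕ._≤_ refl (ℕ.*-comm 3 (k ℕ.* suc a))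
    (FloorMultiple.2m≤3[m/n*n] (suc d) (suc a) a≤d (cases g))))
  where
  x≡ = sym (ℚ.↥p/↧p≡p x)
  k = copies x
  a≤d : suc a ℕ.≤ suc d
  a≤d = /≤1⇒≤ (suc a) d (subst (_≤ 1ℚ) x≡ x≤1)
  cases : Good x → 2 ℕ.* suc a ℕ.≤ suc d ⊎ 2 ℕ.* suc d ℕ.≤ 3 ℕ.* suc a
  cases (inj₁ (_ , x≤½)) = inj₁ (subst₂ ℕ._≤_ (ℕ.*-comm (suc a) 2) (ℕ.+-identityʳ (suc d))
                                   (/-cancel-≤ (suc a) 1 d 1 (subst (_≤ ½) x≡ x≤½)))
  cases (inj₂ ⅔≤x)       = inj₂ (subst₂ ℕ._≤_ refl (ℕ.*-comm (suc a) 3)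
                                   (/-cancel-≤ 2 (suc a) 2 d (subst (⅔ ≤_) x≡ ⅔≤x)))
Good⇒⅔≤fill x@(mkℚ (+ zero) d c) _ g = ⊥-elim (≤0⇒≯0 x (Good⇒0< g))
Good⇒⅔≤fill x@(mkℚ -[1+ _ ] d c) _ g = ⊥-elim (≤0⇒≯0 x (Good⇒0< g))

Accepted : Bool → ℚ → Set
Accepted true  = Good
Accepted false = 0ℚ <_

accepted? : ∀ b → Decidable (Accepted b)
accepted? true  = good?
accepted? false = 0ℚ ℚ.<?_

packFirst : ∀ {P : ℚ → Set} → Decidable P → List ℚ → ℕ
packFirst P? []           = 0
packFirst P? (x ∷ [])     = if does (P? x) then copies x else 0
packFirst P? (x ∷ y ∷ ys) = if does (P? x) then 0 else packFirst P? (y ∷ ys)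

firstFill : ∀ {P : ℚ → Set} → Decidable P → List ℚ → ℚ
firstFill P? []       = 0ℚ
firstFill P? (x ∷ xs) = if does (P? x) then fill x else firstFill P? xs

oneBit : Alg
oneBit t = packFirst (accepted? (t 0))

any-∷ʳ : ∀ {A : Set} (p : A → Bool) xs x → any p (xs ++ [ x ]) ≡ any p xs ∨ p x
any-∷ʳ p []       x = ∨-identityʳ (p x)
any-∷ʳ p (y ∷ ys) x = trans (cong (p y ∨_) (any-∷ʳ p ys x)) (sym (∨-assoc (p y) (any p ys) (p x)))

packFirst-∷ʳ : ∀ {P : ℚ → Set} (P? : Decidable P) seen x →
  packFirst P? (seen ++ [ x ]) ≡ (if any (does ∘ P?) seen then 0 else packFirst P? [ x ])
packFirst-∷ʳ P? []            x = refl
packFirst-∷ʳ P? (s ∷ [])      x with does (P? s)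
... | true  = refl
... | false = refl
packFirst-∷ʳ P? (s ∷ s' ∷ ss) x = skip (does (P? s)) (packFirst-∷ʳ P? (s' ∷ ss) x)
  where
  skip : ∀ b {c n m} → n ≡ (if c then 0 else m) →
    (if b then 0 else n) ≡ (if b ∨ c then 0 else m)
  skip true  _ = refl
  skip false e = e

oneBit-from : ∀ t seen I → packed (decisionsFrom oneBit t seen I) I
  ≡ (if any (does ∘ accepted? (t 0)) seen then 0ℚ else firstFill (accepted? (t 0)) I)
oneBit-from t seen [] with any (does ∘ accepted? (t 0)) seen
... | true  = refl
... | false = refl
oneBit-from t seen (x ∷ xs)
  rewrite packFirst-∷ʳ (accepted? (t 0)) seen x
        | oneBit-from t (seen ++ [ x ]) xs
        | any-∷ʳ (does ∘ accepted? (t 0)) seen x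
  with any (does ∘ accepted? (t 0)) seen | accepted? (t 0) x
... | true  | _     = trans (ℚ.+-identityʳ _) (ℚ.*-zeroˡ x)
... | false | yes _ = ℚ.+-identityʳ (fill x)
... | false | no _  =
  trans (cong (_+ firstFill (accepted? (t 0)) xs) (ℚ.*-zeroˡ x)) (ℚ.+-identityˡ _)

gain-oneBit : ∀ t I → gain oneBit t I ≡ firstFill (accepted? (t 0)) I
gain-oneBit t = oneBit-from t []

firstFill≤1 : ∀ {P : ℚ → Set} (P? : Decidable P) I → firstFill P? I ≤ 1ℚ
firstFill≤1 P? []       = ℚ.nonNegative⁻¹ 1ℚ
firstFill≤1 P? (x ∷ xs) with P? x
... | yes _ = fill≤1 x
... | no _  = firstFill≤1 P? xs

firstFill-Any : ∀ {P Q R : ℚ → Set} (P? : Decidable P) → (∀ {x} → Q x → P x → R (fill x)) →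
  ∀ {I} → All Q I → Any P I → R (firstFill P? I)
firstFill-Any {R = R} P? fill-R {x ∷ _} (q ∷ qs) p with P? x | p
... | yes px | _        = fill-R q px
... | no ¬px | here px  = ⊥-elim (¬px px)
... | no _   | there p' = firstFill-Any {R = R} P? fill-R qs p'

firstFill-All¬ : ∀ {P : ℚ → Set} (P? : Decidable P) {I} → All (¬_ ∘ P) I → firstFill P? I ≡ 0ℚ
firstFill-All¬ P? []                = refl
firstFill-All¬ P? {x ∷ _} (¬px ∷ ¬ps) with P? x
... | yes px = ⊥-elim (¬px px)
... | no _   = firstFill-All¬ P? ¬ps

Middling : ℚ → Set
Middling x = ½ < x × x ≤ ⅔

¬Good⇒0∨Middling : ∀ {x} → 0ℚ ≤ x → ¬ Good x → x ≡ 0ℚ ⊎ Middling x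
¬Good⇒0∨Middling {x} 0≤x ¬g with 0ℚ ℚ.<? x
... | no x≯0  = inj₁ (ℚ.≤-antisym (ℚ.≮⇒≥ x≯0) 0≤x)
... | yes 0<x = inj₂ (ℚ.≰⇒> (¬g ∘ inj₁ ∘ (0<x ,_)) , ℚ.<⇒≤ (ℚ.≰⇒> (¬g ∘ inj₂)))

-- The value of any packing of items from {0} ∪ (½, ⅔] lies in this set.
Sparse : ℚ → Set
Sparse v = v ≡ 0ℚ ⊎ Middling v ⊎ 1ℚ < v

Sparse-scale : ∀ k {x} → 0ℚ ≤ x → x ≡ 0ℚ ⊎ Middling x → Sparse (ℕ→ℚ k * x)
Sparse-scale zero          {x} _   _              = inj₁ (ℚ.*-zeroˡ x)
Sparse-scale (suc zero)    {x} _   (inj₁ x≡0)     = inj₁ (trans (ℚ.*-identityˡ x) x≡0)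
Sparse-scale (suc zero)    {x} _   (inj₂ m)       =
  inj₂ (inj₁ (subst Middling (sym (ℚ.*-identityˡ x)) m))
Sparse-scale (suc (suc k)) {x} _   (inj₁ refl)    = inj₁ (ℚ.*-zeroʳ (ℕ→ℚ (suc (suc k))))
Sparse-scale (suc (suc k)) {x} 0≤x (inj₂ (½<x , _)) = inj₂ (inj₂ (begin-strict
  1ℚ                 ≡⟨⟩
  ℕ→ℚ 2 * ½          <⟨ ℚ.*-monoʳ-<-pos (ℕ→ℚ 2) ½<x ⟩
  ℕ→ℚ 2 * x          ≤⟨ ℚ.*-monoʳ-≤-nonNeg x {{ℚ.nonNegative 0≤x}} 2≤2+k ⟩
  ℕ→ℚ (2 ℕ.+ k) * x  ∎))
  where
  open ℚ.≤-Reasoning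
  2≤2+k : ℕ→ℚ 2 ≤ ℕ→ℚ (2 ℕ.+ k)
  2≤2+k = /-mono-≤ 2 (2 ℕ.+ k) 0 0 (ℕ.*-monoˡ-≤ 1 (ℕ.m≤m+n 2 k))

Sparse-+ : ∀ {v w} → 0ℚ ≤ v → 0ℚ ≤ w → Sparse v → Sparse w → Sparse (v + w)
Sparse-+ {w = w} _ _ (inj₁ refl) sw = subst Sparse (sym (ℚ.+-identityˡ w)) sw
Sparse-+ {v} _ _ (inj₂ sv) (inj₁ refl) = subst Sparse (sym (ℚ.+-identityʳ v)) (inj₂ sv)
Sparse-+ _ _ (inj₂ (inj₁ (½<v , _))) (inj₂ (inj₁ (½<w , _))) = inj₂ (inj₂ (ℚ.+-mono-< ½<v ½<w))
Sparse-+ _ 0≤w (inj₂ (inj₂ 1<v)) (inj₂ _) = inj₂ (inj₂ (ℚ.+-mono-<-≤ 1<v 0≤w))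
Sparse-+ 0≤v _ (inj₂ (inj₁ _)) (inj₂ (inj₂ 1<w)) = inj₂ (inj₂ (ℚ.+-mono-≤-< 0≤v 1<w))

packed-Sparse : ∀ {I} → ValidInst I → All (λ x → x ≡ 0ℚ ⊎ Middling x) I →
  ∀ ks → Sparse (packed ks I)
packed-Sparse _        _        []       = inj₁ refl
packed-Sparse []       _        (_ ∷ _)  = inj₁ refl
packed-Sparse (v ∷ vs) (b ∷ bs) (k ∷ ks) = Sparse-+ (0≤k*x k (proj₁ v)) (packed-nonneg vs ks)
  (Sparse-scale k (proj₁ v) b) (packed-Sparse vs bs ks)

Sparse-≤1⇒≤⅔ : ∀ {v} → Sparse v → v ≤ 1ℚ → v ≤ ⅔
Sparse-≤1⇒≤⅔ (inj₁ refl)           _   = ℚ.nonNegative⁻¹ ⅔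
Sparse-≤1⇒≤⅔ (inj₂ (inj₁ (_ , m))) _   = m
Sparse-≤1⇒≤⅔ (inj₂ (inj₂ 1<v))     v≤1 = ⊥-elim (ℚ.<-irrefl refl (ℚ.<-≤-trans 1<v v≤1))

⅔≤3/2*½ : ⅔ ≤ 3/2 * ½
⅔≤3/2*½ = toWitness {a? = ⅔ ℚ.≤? 3/2 * ½} tt

competitive-with-Good : ∀ {I} → ValidInst I → Any Good I →
  ∀ ks → packed ks I ≤ 1ℚ → packed ks I ≤ 3/2 * firstFill good? I
competitive-with-Good valid some-good ks fits = ℚ.≤-trans fits (ℚ.*-monoˡ-≤-nonNeg 3/2
  (firstFill-Any {R = ⅔ ≤_} good? (λ v → Good⇒⅔≤fill _ (proj₂ v)) valid some-good))

competitive-without-Good : ∀ {I} → ValidInst I → ¬ Any Good I →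
  ∀ ks → packed ks I ≤ 1ℚ → packed ks I ≤ 3/2 * firstFill (0ℚ ℚ.<?_) I
competitive-without-Good {I} valid no-good ks fits with any? (0ℚ ℚ.<?_) I
... | yes some-pos = begin
  packed ks I                   ≤⟨ Sparse-≤1⇒≤⅔ (packed-Sparse valid bad ks) fits ⟩
  ⅔                             ≤⟨ ⅔≤3/2*½ ⟩
  3/2 * ½                       ≤⟨ ℚ.*-monoˡ-≤-nonNeg 3/2 (ℚ.<⇒≤ ½<firstFill) ⟩
  3/2 * firstFill (0ℚ ℚ.<?_) I  ∎
  where
  open ℚ.≤-Reasoning
  bad : All (λ x → x ≡ 0ℚ ⊎ Middling x) I
  bad = All.zipWith (λ (v , ¬g) → ¬Good⇒0∨Middling (proj₁ v) ¬g) (valid , ¬Any⇒All¬ I no-good)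
  ½<fill : ∀ {x} → (0ℚ ≤ x × x ≤ 1ℚ) × (x ≡ 0ℚ ⊎ Middling x) → 0ℚ < x → ½ < fill x
  ½<fill (_ , inj₁ refl)              0<0 = ⊥-elim (ℚ.<-irrefl refl 0<0)
  ½<fill ((_ , x≤1) , inj₂ (½<x , _)) 0<x = ℚ.<-≤-trans ½<x (≤fill _ 0<x x≤1)
  ½<firstFill : ½ < firstFill (0ℚ ℚ.<?_) I
  ½<firstFill = firstFill-Any {R = ½ <_} (0ℚ ℚ.<?_) ½<fill (All.zip (valid , bad)) some-pos
... | no no-pos = ℚ.≤-reflexive (begin
  packed ks I                   ≡⟨ packed-zeros zeros ks ⟩
  0ℚ                            ≡⟨ ℚ.*-zeroʳ 3/2 ⟨
  3/2 * 0ℚ                      ≡⟨ cong (3/2 *_) (firstFill-All¬ (0ℚ ℚ.<?_) (¬Any⇒All¬ I no-pos)) ⟨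
  3/2 * firstFill (0ℚ ℚ.<?_) I  ∎)
  where
  open ≡-Reasoning
  zeros : All (_≡ 0ℚ) I
  zeros = All.zipWith (λ (v , x≯0) → ℚ.≤-antisym (ℚ.≮⇒≥ x≯0) (proj₁ v))
                      (valid , ¬Any⇒All¬ I no-pos)

oneBit-valid : ValidAlg oneBit
oneBit-valid t I _ = subst (_≤ 1ℚ) (sym (gain-oneBit t I)) (firstFill≤1 (accepted? (t 0)) I)

oneBit-reads-1 : ReadsAtMost oneBit 1 AllInstances
oneBit-reads-1 I _ _ t t' agree =
  decisionsFrom-cong (λ s → cong (λ b → packFirst (accepted? b) s) (agree 0 ℕ.z<s)) [] I

oneBit-competitive : CompetitiveOn oneBit 3/2 AllInstances
oneBit-competitive I valid _ with any? good? I
... | yes some-good = (λ _ → true) , λ ks (_ , fits) → subst (λ g → packed ks I ≤ 3/2 * g)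
  (sym (gain-oneBit (λ _ → true) I)) (competitive-with-Good valid some-good ks fits)
... | no no-good = (λ _ → false) , λ ks (_ , fits) → subst (λ g → packed ks I ≤ 3/2 * g)
  (sym (gain-oneBit (λ _ → false) I)) (competitive-without-Good valid no-good ks fits)

-- The lower bound

leadingZeros : ℕ → (ℕ → ℕ) → ℕ
leadingZeros zero    ρ = 0
leadingZeros (suc m) ρ with ρ 0
... | zero  = suc (leadingZeros m (ρ ∘ suc))
... | suc _ = 0

leadingZeros-cong : ∀ m {ρ ρ'} → (∀ l → l ℕ.< m → ρ l ≡ ρ' l) →
  leadingZeros m ρ ≡ leadingZeros m ρ'
leadingZeros-cong zero    _ = refl
leadingZeros-cong (suc m) {ρ} {ρ'} eq with ρ 0 | ρ' 0 | eq 0 ℕ.z<s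
... | zero  | zero  | _ = cong suc (leadingZeros-cong m λ l l<m → eq (suc l) (ℕ.s<s l<m))
... | suc _ | suc _ | _ = refl

leadingZeros-≡ : ∀ m k ρ → k ℕ.≤ m →
  (∀ l → l ℕ.< k → ρ l ≡ 0) → (k ℕ.< m → ρ k ≢ 0) → leadingZeros m ρ ≡ k
leadingZeros-≡ zero    zero    ρ _ _ _ = refl
leadingZeros-≡ (suc m) zero    ρ _ _ ρ0≢0 with ρ 0 | ρ0≢0 ℕ.z<s
... | zero  | ρ0≢0' = ⊥-elim (ρ0≢0' refl)
... | suc _ | _     = refl
leadingZeros-≡ (suc m) (suc k) ρ k<m zeros ρk≢0 rewrite zeros 0 ℕ.z<s = cong suc
  (leadingZeros-≡ m k (ρ ∘ suc) (ℕ.s≤s⁻¹ k<m)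
    (λ l l<k → zeros (suc l) (ℕ.s<s l<k)) (λ k<m → ρk≢0 (ℕ.s<s k<m)))

bit : Bool → Fin 2
bit false = Fin.zero
bit true  = Fin.suc Fin.zero

bit-injective : ∀ {a b} → bit a ≡ bit b → a ≡ b
bit-injective {false} {false} _ = refl
bit-injective {true}  {true}  _ = refl

prefixCode : ∀ b → Tape → Fin (2 ^ b)
prefixCode zero    t = Fin.zero
prefixCode (suc b) t = combine (bit (t 0)) (prefixCode b (t ∘ suc))

prefixCode-injective : ∀ b {t t'} → prefixCode b t ≡ prefixCode b t' → ∀ i → i ℕ.< b → t i ≡ t' i
prefixCode-injective (suc b) {t} {t'} eq i i<b
  with Fin.combine-injective (bit (t 0)) (prefixCode b (t ∘ suc)) (bit (t' 0)) (prefixCode b (t' ∘ suc)) eq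
prefixCode-injective (suc b) eq zero    _   | head≡ , _ = bit-injective head≡
prefixCode-injective (suc b) eq (suc i) i<b | _ , tail≡ = prefixCode-injective b tail≡ i (ℕ.s<s⁻¹ i<b)

ratio-threshold : ∀ r → r < 3/2 → ∀ n → Σ ℕ λ K → 2 ℕ.* n ℕ.< suc K ×
  (∀ V → V ℕ.≤ 2 ℕ.* suc K ℕ.+ 2 ℕ.* n → r * (+ V / (3 ℕ.* suc K)) < 1ℚ)
ratio-threshold r@(mkℚ -[1+ _ ] _ _) _ n = 2 ℕ.* n , ℕ.n<1+n _ , λ V _ → begin-strict
  r * (+ V / (3 ℕ.* suc (2 ℕ.* n)))  ≤⟨ ℚ.*-monoˡ-≤-nonPos r {{r≤0}} (0≤/ V _) ⟩
  r * 0ℚ                            ≡⟨ ℚ.*-zeroʳ r ⟩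
  0ℚ                                <⟨ ℚ.positive⁻¹ 1ℚ ⟩
  1ℚ                                ∎
  where
  open ℚ.≤-Reasoning
  r≤0 = ℚ.nonPositive (ℚ.<⇒≤ (ℚ.negative⁻¹ r))
ratio-threshold r@(mkℚ (+ a) q _) r<3/2 n = _ , 2n<M , λ V V≤B →
  subst (_< 1ℚ) (r*V/T V) (<⇒/<1 (a ℕ.* V) _ (aV<[1+q]T q V 1+2a≤3[1+q] V≤B))
  where
  open Scale a n
  1+2a≤3[1+q] : suc (a ℕ.* 2) ℕ.≤ 3 ℕ.* suc q
  1+2a≤3[1+q] = /-cancel-< a 3 q 1 (subst (_< 3/2) (sym (ℚ.↥p/↧p≡p r)) r<3/2)
  r*V/T : ∀ V → + (a ℕ.* V) / (suc q ℕ.* (3 ℕ.* M)) ≡ r * (+ V / (3 ℕ.* M))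
  r*V/T V = trans (/-*-interchange a V q _) (cong (_* (+ V / (3 ℕ.* M))) (ℚ.↥p/↧p≡p r))

WithinRatio : Alg → ℚ → Tape → Instance → Set
WithinRatio A r t I = ∀ ks → Feasible ks I → packed ks I ≤ r * gain A t I

module HardInstances (m K : ℕ) (room : 2 ℕ.* suc m ℕ.< suc K) where

  open PrefixLoad (suc K) (suc m) room

  scaled : ℕ → ℚ
  scaled a = + a / T

  scaled-valid : ∀ {a} → a ℕ.≤ T → 0ℚ ≤ scaled a × scaled a ≤ 1ℚ
  scaled-valid {a} a≤T = 0≤/ a _ , ≤⇒/≤1 a _ a≤T

  scaled-T : scaled T ≡ 1ℚ
  scaled-T =
    ℚ.≤-antisym (≤⇒/≤1 T _ ℕ.≤-refl) (/-mono-≤ 1 T 0 _ (ℕ.≤-reflexive (ℕ.*-comm 1 T)))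

  prefix : ℕ → Instance
  prefix zero    = []
  prefix (suc l) = prefix l ++ [ scaled (big l) ]

  length-prefix : ∀ k → length (prefix k) ≡ k
  length-prefix-∷ʳ : ∀ k x → length (prefix k ++ [ x ]) ≡ suc k

  length-prefix zero    = refl
  length-prefix (suc k) = length-prefix-∷ʳ k (scaled (big k))

  length-prefix-∷ʳ k x = trans (length-∷ʳ (prefix k) x) (cong suc (length-prefix k))

  valid-prefix : ∀ k → ValidInst (prefix k)
  valid-prefix zero    = []
  valid-prefix (suc k) = ++⁺ (valid-prefix k) (scaled-valid (big≤T k) ∷ [])

  hard : Fin (suc m) → Instance
  hard Fin.zero    = prefix m ++ [ scaled T ]
  hard (Fin.suc j) = prefix (suc (toℕ j)) ++ [ scaled (small (toℕ j)) ]

  label : Fin (suc m) → ℕ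
  label Fin.zero    = m
  label (Fin.suc j) = toℕ j

  label-injective : Injective _≡_ _≡_ label
  label-injective {Fin.zero}  {Fin.zero}  _  = refl
  label-injective {Fin.suc i} {Fin.suc j} eq = cong Fin.suc (Fin.toℕ-injective eq)
  label-injective {Fin.zero}  {Fin.suc j} eq = ⊥-elim (ℕ.<-irrefl (sym eq) (Fin.toℕ<n j))
  label-injective {Fin.suc i} {Fin.zero}  eq = ⊥-elim (ℕ.<-irrefl eq (Fin.toℕ<n i))

  valid-hard : ∀ i → ValidInst (hard i)
  valid-hard Fin.zero    = ++⁺ (valid-prefix m) (scaled-valid ℕ.≤-refl ∷ [])
  valid-hard (Fin.suc j) =
    ++⁺ (valid-prefix (suc (toℕ j))) (scaled-valid (small≤T (ℕ.m<n⇒m<1+n (Fin.toℕ<n j))) ∷ [])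

  short-hard : ∀ i → LengthAtMost (suc m) (hard i)
  short-hard Fin.zero    = ℕ.≤-reflexive (length-prefix-∷ʳ m _)
  short-hard (Fin.suc j) =
    ℕ.≤-trans (ℕ.≤-reflexive (length-prefix-∷ʳ (suc (toℕ j)) _)) (ℕ.s≤s (Fin.toℕ<n j))

  fillable-hard : ∀ i → Fillable (hard i)
  fillable-hard Fin.zero    = Fillable-++ (prefix m) ([ 1 ] , (refl , ℚ.≤-reflexive full) , full)
    where
    full : packed [ 1 ] [ scaled T ] ≡ 1ℚ
    full = trans (ℚ.+-identityʳ (1ℚ * scaled T)) (trans (ℚ.*-identityˡ (scaled T)) scaled-T)
  fillable-hard (Fin.suc j) = subst Fillable (sym (List.++-assoc (prefix k) [ x ] [ y ]))
    (Fillable-++ (prefix k) (1 ∷ 1 ∷ [] , (refl , ℚ.≤-reflexive full) , full))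
    where
    open ≡-Reasoning
    k = toℕ j
    x = scaled (big k)
    y = scaled (small k)
    full : packed (1 ∷ 1 ∷ []) (x ∷ y ∷ []) ≡ 1ℚ
    full = begin
      1ℚ * x + (1ℚ * y + 0ℚ)      ≡⟨ cong (_+_ (1ℚ * x)) (ℚ.+-identityʳ (1ℚ * y)) ⟩
      1ℚ * x + 1ℚ * y             ≡⟨ cong₂ _+_ (ℚ.*-identityˡ x) (ℚ.*-identityˡ y) ⟩
      x + y                       ≡⟨ +-distrib-/ (big k) (small k) _ ⟨
      scaled (big k ℕ.+ small k)  ≡⟨ cong scaled (big+small≡T (ℕ.m<n⇒m<1+n (Fin.toℕ<n j))) ⟩
      scaled T                    ≡⟨ scaled-T ⟩
      1ℚ                          ∎

  responses : Alg → Tape → ℕ → ℕ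
  responses A t l = A t (prefix (suc l))

  gain-prefix : ∀ A t k → gain A t (prefix k) ≡ scaled (load (responses A t) k)
  gain-prefix-∷ʳ : ∀ A t k c → let e = A t (prefix k ++ [ scaled c ]) in
    gain A t (prefix k ++ [ scaled c ]) ≡ scaled (load (responses A t) k ℕ.+ e ℕ.* c)

  gain-prefix A t zero    = sym (ℚ.0/n≡0 T)
  gain-prefix A t (suc k) = gain-prefix-∷ʳ A t k (big k)

  gain-prefix-∷ʳ A t k c = begin
    gain A t (prefix k ++ [ scaled c ])   ≡⟨ gain-∷ʳ A t (prefix k) (scaled c) ⟩
    gain A t (prefix k) + ℕ→ℚ e * scaled c
      ≡⟨ cong₂ _+_ (gain-prefix A t k) (sym (*-/-assoc e c _)) ⟩
    scaled L + scaled (e ℕ.* c)            ≡⟨ +-distrib-/ L (e ℕ.* c) _ ⟨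
    scaled (L ℕ.+ e ℕ.* c)                 ∎
    where
    open ≡-Reasoning
    e = A t (prefix k ++ [ scaled c ])
    L = load (responses A t) k

  module _ {A : Alg} (valid : ValidAlg A) {r : ℚ} (ratio : ∀ V → V ℕ.≤ B → r * scaled V < 1ℚ) where

    window : ∀ {I t V} → ValidInst I → Fillable I → WithinRatio A r t I →
      gain A t I ≡ scaled V → Window V
    window {I} {t} {V} vI (ks , feasible , full) within gain≡ = B<V , V≤T
      where
      V≤T : V ℕ.≤ T
      V≤T = /≤1⇒≤ V _ (subst (_≤ 1ℚ) gain≡ (valid t I vI))
      B<V : B ℕ.< V
      B<V = ℕ.≰⇒> λ V≤B → ℚ.<-irrefl refl
        (ℚ.<-≤-trans (ratio V V≤B) (subst₂ _≤_ full (cong (r *_) gain≡) (within ks feasible)))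

    forced : ∀ i t → WithinRatio A r t (hard i) → leadingZeros m (responses A t) ≡ label i
    forced Fin.zero t within = leadingZeros-≡ m m ρ ℕ.≤-refl
      (load≡0⇒zeros ρ m (ℕ.n≤1+n m) empty) (λ m<m → ⊥-elim (ℕ.<-irrefl refl m<m))
      where
      ρ = responses A t
      empty = forced-empty ρ m (A t (hard Fin.zero)) (ℕ.n≤1+n m)
        (window (valid-hard Fin.zero) (fillable-hard Fin.zero) within (gain-prefix-∷ʳ A t m T))
    forced (Fin.suc j) t within = leadingZeros-≡ m k ρ (ℕ.<⇒≤ k<m)
      (load≡0⇒zeros ρ k (ℕ.<⇒≤ k<n) (proj₁ split)) (λ _ → proj₂ split)
      where
      ρ = responses A t
      k = toℕ j
      k<m = Fin.toℕ<n j
      k<n = ℕ.m<n⇒m<1+n k<m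
      split = forced-split ρ k (A t (hard (Fin.suc j))) k<n (window (valid-hard (Fin.suc j))
        (fillable-hard (Fin.suc j)) within (gain-prefix-∷ʳ A t (suc k) (small k)))

  responses-agree : ∀ {A b} → ReadsAtMost A b (LengthAtMost (suc m)) →
    ∀ {t t'} → (∀ i → i ℕ.< b → t i ≡ t' i) →
    ∀ l → l ℕ.< m → responses A t l ≡ responses A t' l
  responses-agree reads agree l l<m = last-decision (prefix l) (scaled (big l))
    (reads (prefix (suc l)) (valid-prefix (suc l)) short _ _ agree)
    where
    short : length (prefix (suc l)) ℕ.≤ suc m
    short = ℕ.≤-trans (ℕ.≤-reflexive (length-prefix (suc l))) (ℕ.s≤s (ℕ.<⇒≤ l<m))

advice-lower-bound : ∀ n A b → ValidAlg A → ReadsAtMost A b (LengthAtMost n) →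
  (Σ ℚ λ r → r < 3/2 × CompetitiveOn A r (LengthAtMost n)) → n ∸ 1 ℕ.< 2 ^ b
advice-lower-bound zero    A b _ _ _ = ℕ.m^n>0 2 b
advice-lower-bound (suc m) A b valid reads (r , r<3/2 , competitive) with ratio-threshold r r<3/2 (suc m)
... | K , room , ratio = Fin.injective⇒≤ code-injective
  where
  open HardInstances m K room
  best : ∀ i → Σ Tape λ t → WithinRatio A r t (hard i)
  best i = competitive (hard i) (valid-hard i) (short-hard i)
  advice : Fin (suc m) → Tape
  advice i = proj₁ (best i)
  forced-label : ∀ i → leadingZeros m (responses A (advice i)) ≡ label i
  forced-label i = forced valid {r} ratio i (advice i) (proj₂ (best i))
  code : Fin (suc m) → Fin (2 ^ b)
  code i = prefixCode b (advice i)
  code-injective : Injective _≡_ _≡_ code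
  code-injective {i} {j} code≡ = label-injective (begin
    label i                                  ≡⟨ forced-label i ⟨
    leadingZeros m (responses A (advice i))
      ≡⟨ leadingZeros-cong m (responses-agree reads (prefixCode-injective b code≡)) ⟩
    leadingZeros m (responses A (advice j))  ≡⟨ forced-label j ⟩
    label j                                  ∎)
    where open ≡-Reasoning

constant-advice-insufficient : ∀ k A → ValidAlg A → ReadsAtMost A k AllInstances →
  ¬ (Σ ℚ λ r → r < 3/2 × CompetitiveOn A r AllInstances)
constant-advice-insufficient k A valid reads (r , r<3/2 , competitive) = ℕ.<-irrefl refl
  (advice-lower-bound (suc (2 ^ k)) A k valid
    (λ I v _ → reads I v tt) (r , r<3/2 , λ I v _ → competitive I v tt))

theorem5 :
      (Σ Alg λ A → ValidAlg A × ReadsAtMost A 1 AllInstances × CompetitiveOn A 3/2 AllInstances)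
    × (∀ (k : ℕ) → 0 ℕ.< k → ∀ (A : Alg) → ValidAlg A → ReadsAtMost A k AllInstances →
         ¬ (Σ ℚ λ r → (r < 3/2) × CompetitiveOn A r AllInstances))
    × (∀ (n : ℕ) (A : Alg) (b : ℕ) → ValidAlg A → ReadsAtMost A b (LengthAtMost n) →
         (Σ ℚ λ r → (r < 3/2) × CompetitiveOn A r (LengthAtMost n)) →
         n ∸ 1 ℕ.< 2 ^ b)
theorem5 = (oneBit , oneBit-valid , oneBit-reads-1 , oneBit-competitive)
         , (λ k _ → constant-advice-insufficient k)
         , advice-lower-bound
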